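{- For $n\geq 0$ let $f_n(q)=\sum_{k=0}^n\binom{n}{k}\binom{2n-2k}{n-k}q^k$. Then the sequence $\{f_n(q)\}_{n\geq 0}$ is $q$-log-convex.
   Context: A sequence of real polynomials $\{f_n(q)\}_{n\geq 0}$ is $q$-log-convex if for every $n\geq 1$ the polynomial $f_{n+1}(q)f_{n-1}(q)-f_n^2(q)$ has nonnegative coefficients. -}

module Defs where

open import Data.Nat using (ℕ; zero; suc; _+_; _*_; _∸_; _≤_)
open import Data.Nat.Combinatorics using (_C_)
open import Data.Integer as ℤ using (ℤ; +_)

-- A real polynomial with integer coefficients is represented by its
-- coefficient function  ℕ → ℤ  (coefficient of q^k).  All polynomials
-- below are finitely supported.
Poly : Set
Poly = ℕ → ℤ

sumTo : ℕ → (ℕ → ℤ) → ℤ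
sumTo zero    g = g 0
sumTo (suc n) g = sumTo n g ℤ.+ g (suc n)

_⊛_ : Poly → Poly → Poly
(p ⊛ r) k = sumTo k (λ i → p i ℤ.* r (k ∸ i))

_⊝_ : Poly → Poly → Poly
(p ⊝ r) k = p k ℤ.- r k

NonnegCoeffs : Poly → Set
NonnegCoeffs p = ∀ k → + 0 ℤ.≤ p k

QLogConvex : (ℕ → Poly) → Set
QLogConvex f = ∀ n → 1 ≤ n → NonnegCoeffs ((f (suc n) ⊛ f (n ∸ 1)) ⊝ (f n ⊛ f n))

-- f_n(q) = Σ_{k=0}^{n} C(n,k) C(2n-2k, n-k) q^k.
-- For k > n, C(n,k) = 0, so the coefficient vanishes automatically.
f : ℕ → Poly
f n k = + ((n C k) * ((2 * n ∸ 2 * k) C (n ∸ k)))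

module Submission where

-- f n is the binomial transform T c n = Σₖ C(n,k) c(n−k) qᵏ of the central binomial
-- coefficients c(k) = C(2k,k), which are log-convex because (k+1) c(k+1) = 2(2k+1) c(k).
-- For any log-convex a, Pascal's rule gives T a (n+1) = T (a ∘ suc) n + q T a n;
-- applied twice, the q-terms cancel and
--   T a (n+2) T a n − (T a (n+1))² = T (a ∘ suc ∘ suc) n T a n − (T (a ∘ suc) n)².
-- In the coefficient of qᵐ on the right, the terms i and m−i together equal
-- C(n,i) C(n,m−i) [a(x+2) a(y) + a(y+2) a(x) − 2 a(x+1) a(y+1)] with x = n−i,
-- y = n−(m−i); log-convexity bounds (a(x+1) a(y+1))² by the product of the two
-- other terms, so the bracket is nonnegative by AM-GM.

open import Defs

module LogConvexSequences where

  open import Data.Nat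
  open import Data.Nat.Properties
  open import Data.Nat.Combinatorics using (_C_; nCk+nC[k+1]≡[n+1]C[k+1]; nCk≡nC[n∸k]; nC1≡n)
  open import Data.Nat.Tactic.RingSolver using (solve-∀)
  open import Data.Sum using ([_,_]′)
  open import Relation.Binary.PropositionalEquality
  open import Relation.Nullary using (yes; no; contradiction)

  [1+k]*[1+n]C[1+k]≡[1+n]*nCk : ∀ n k → suc k * (suc n C suc k) ≡ suc n * (n C k)
  [1+k]*[1+n]C[1+k]≡[1+n]*nCk zero    zero    = refl
  [1+k]*[1+n]C[1+k]≡[1+n]*nCk zero    (suc k) = *-zeroʳ (suc (suc k))
  [1+k]*[1+n]C[1+k]≡[1+n]*nCk (suc n) zero    = trans (+-identityʳ _) (trans (nC1≡n (suc (suc n))) (sym (*-identityʳ _)))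
  [1+k]*[1+n]C[1+k]≡[1+n]*nCk (suc n) (suc k) = begin
    suc (suc k) * (suc (suc n) C suc (suc k))
      ≡⟨ cong (suc (suc k) *_) (nCk+nC[k+1]≡[n+1]C[k+1] (suc n) (suc k)) ⟨
    suc (suc k) * (x + y)
      ≡⟨ split (suc k) x y ⟩
    (suc k * x + suc (suc k) * y) + x
      ≡⟨ cong₂ (λ u v → (u + v) + x) ([1+k]*[1+n]C[1+k]≡[1+n]*nCk n k) ([1+k]*[1+n]C[1+k]≡[1+n]*nCk n (suc k)) ⟩
    (suc n * (n C k) + suc n * (n C suc k)) + x
      ≡⟨ cong (_+ x) (*-distribˡ-+ (suc n) (n C k) (n C suc k)) ⟨
    suc n * (n C k + n C suc k) + x
      ≡⟨ cong (λ z → suc n * z + x) (nCk+nC[k+1]≡[n+1]C[k+1] n k) ⟩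
    suc n * x + x
      ≡⟨ +-comm (suc n * x) x ⟩
    suc (suc n) * x ∎
    where
    open ≡-Reasoning
    x = suc n C suc k
    y = suc n C suc (suc k)
    split : ∀ k x y → suc k * (x + y) ≡ (k * x + suc k * y) + x
    split = solve-∀

  centralBinomial : ℕ → ℕ
  centralBinomial k = (2 * k) C k

  [1+k]*central[1+k]≡2[2k+1]*central[k] : ∀ k → suc k * centralBinomial (suc k) ≡ 2 * suc (2 * k) * centralBinomial k
  [1+k]*central[1+k]≡2[2k+1]*central[k] k = *-cancelˡ-≡ _ _ (suc k) (begin
    suc k * (suc k * (2 * suc k C suc k))
      ≡⟨ cong (λ z → suc k * (suc k * (z C suc k))) (*-suc 2 k) ⟩
    suc k * (suc k * (suc (suc (2 * k)) C suc k))
      ≡⟨ cong (suc k *_) ([1+k]*[1+n]C[1+k]≡[1+n]*nCk (suc (2 * k)) k) ⟩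
    suc k * (suc (suc (2 * k)) * (suc (2 * k) C k))
      ≡⟨ cong (λ z → suc k * (suc (suc (2 * k)) * z)) symmetry ⟩
    suc k * (suc (suc (2 * k)) * (suc (2 * k) C suc k))
      ≡⟨ x∙yz≡y∙xz (suc k) (suc (suc (2 * k))) (suc (2 * k) C suc k) ⟩
    suc (suc (2 * k)) * (suc k * (suc (2 * k) C suc k))
      ≡⟨ cong (suc (suc (2 * k)) *_) ([1+k]*[1+n]C[1+k]≡[1+n]*nCk (2 * k) k) ⟩
    suc (suc (2 * k)) * (suc (2 * k) * centralBinomial k)
      ≡⟨ regroup k (centralBinomial k) ⟩
    suc k * (2 * suc (2 * k) * centralBinomial k) ∎)
    where
    open ≡-Reasoning
    k≤2k : k ≤ 2 * k
    k≤2k = m≤n*m k 2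
    symmetry : suc (2 * k) C k ≡ suc (2 * k) C suc k
    symmetry = begin
      suc (2 * k) C k                  ≡⟨ nCk≡nC[n∸k] (m≤n⇒m≤1+n k≤2k) ⟩
      suc (2 * k) C (suc (2 * k) ∸ k)  ≡⟨ cong (suc (2 * k) C_) (+-∸-assoc 1 k≤2k) ⟩
      suc (2 * k) C suc (2 * k ∸ k)    ≡⟨ cong (λ z → suc (2 * k) C suc z) (trans (m+n∸m≡n k (k + 0)) (+-identityʳ k)) ⟩
      suc (2 * k) C suc k ∎
    x∙yz≡y∙xz : ∀ x y z → x * (y * z) ≡ y * (x * z)
    x∙yz≡y∙xz = solve-∀
    regroup : ∀ k a → suc (suc (2 * k)) * (suc (2 * k) * a) ≡ suc k * (2 * suc (2 * k) * a)
    regroup = solve-∀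

  LogConvex : (ℕ → ℕ) → Set
  LogConvex a = ∀ k → a (suc k) * a (suc k) ≤ a (suc (suc k)) * a k

  -- Multiplying the recurrences at k and k + 1 gives c₁² N = c₂ c₀ M with N ≥ M.
  centralBinomial-logConvex : LogConvex centralBinomial
  centralBinomial-logConvex k = *-cancelʳ-≤ (c₁ * c₁) (c₂ * c₀) M (begin
    c₁ * c₁ * M
      ≤⟨ *-monoʳ-≤ (c₁ * c₁) (subst (M ≤_) (sym (N≡M+2[k+1] k)) (m≤m+n M (2 * suc k))) ⟩
    c₁ * c₁ * N
      ≡⟨ regroupN k c₁ ⟩
    (2 * suc (2 * suc k) * c₁) * suc k * (suc k * c₁)
      ≡⟨ cong₂ (λ u v → u * suc k * v) (sym ([1+k]*central[1+k]≡2[2k+1]*central[k] (suc k))) ([1+k]*central[1+k]≡2[2k+1]*central[k] k) ⟩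
    (suc (suc k) * c₂) * suc k * (2 * suc (2 * k) * c₀)
      ≡⟨ regroupM k c₀ c₂ ⟩
    c₂ * c₀ * M ∎)
    where
    open ≤-Reasoning
    c₀ = centralBinomial k
    c₁ = centralBinomial (suc k)
    c₂ = centralBinomial (suc (suc k))
    M = suc (suc k) * suc k * (2 * suc (2 * k))
    N = 2 * suc (2 * suc k) * suc k * suc k
    N≡M+2[k+1] : ∀ k → 2 * suc (2 * suc k) * suc k * suc k ≡ suc (suc k) * suc k * (2 * suc (2 * k)) + 2 * suc k
    N≡M+2[k+1] = solve-∀
    regroupN : ∀ k x → x * x * (2 * suc (2 * suc k) * suc k * suc k) ≡ (2 * suc (2 * suc k) * x) * suc k * (suc k * x)
    regroupN = solve-∀
    regroupM : ∀ k a b → (suc (suc k) * b) * suc k * (2 * suc (2 * k) * a) ≡ b * a * (suc (suc k) * suc k * (2 * suc (2 * k)))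
    regroupM = solve-∀

  m*m≤n*n⇒m≤n : ∀ m n → m * m ≤ n * n → m ≤ n
  m*m≤n*n⇒m≤n m n m²≤n² with m ≤? n
  ... | yes m≤n = m≤n
  ... | no  m≰n = contradiction m²≤n² (<⇒≱ (*-mono-< (≰⇒> m≰n) (≰⇒> m≰n)))

  4*[m*n]≤[m+n]*[m+n] : ∀ m n → 4 * (m * n) ≤ (m + n) * (m + n)
  4*[m*n]≤[m+n]*[m+n] m n = [ ≤-case m n , flip ]′ (≤-total m n)
    where
    square-gap : ∀ m t → (m + (m + t)) * (m + (m + t)) ≡ 4 * (m * (m + t)) + t * t
    square-gap = solve-∀
    ≤-case : ∀ m n → m ≤ n → 4 * (m * n) ≤ (m + n) * (m + n)
    ≤-case m n m≤n rewrite sym (m+[n∸m]≡n m≤n) = subst (4 * (m * (m + (n ∸ m))) ≤_) (sym (square-gap m (n ∸ m))) (m≤m+n _ _)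
    flip : n ≤ m → 4 * (m * n) ≤ (m + n) * (m + n)
    flip n≤m = subst₂ _≤_ (cong (4 *_) (*-comm n m)) (cong₂ _*_ (+-comm n m) (+-comm n m)) (≤-case n m n≤m)

  z*z≤x*y⇒2*z≤x+y : ∀ x y z → z * z ≤ x * y → 2 * z ≤ x + y
  z*z≤x*y⇒2*z≤x+y x y z z²≤xy = m*m≤n*n⇒m≤n (2 * z) (x + y) (begin
    (2 * z) * (2 * z) ≡⟨ [2z]²≡4z² z ⟩
    4 * (z * z)       ≤⟨ *-monoʳ-≤ 4 z²≤xy ⟩
    4 * (x * y)       ≤⟨ 4*[m*n]≤[m+n]*[m+n] x y ⟩
    (x + y) * (x + y) ∎)
    where
    open ≤-Reasoning
    [2z]²≡4z² : ∀ z → (2 * z) * (2 * z) ≡ 4 * (z * z)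
    [2z]²≡4z² = solve-∀

  logConvex⇒cross : ∀ {a} → LogConvex a → ∀ x y →
                    2 * (a (suc x) * a (suc y)) ≤ a (suc (suc x)) * a y + a (suc (suc y)) * a x
  logConvex⇒cross {a} logConvex x y = z*z≤x*y⇒2*z≤x+y (a₂x * a₀y) (a₂y * a₀x) (a₁x * a₁y) (begin
    (a₁x * a₁y) * (a₁x * a₁y) ≡⟨ interchange a₁x a₁y a₁x a₁y ⟩
    (a₁x * a₁x) * (a₁y * a₁y) ≤⟨ *-mono-≤ (logConvex x) (logConvex y) ⟩
    (a₂x * a₀x) * (a₂y * a₀y) ≡⟨ interchange a₂x a₀x a₂y a₀y ⟩
    (a₂x * a₂y) * (a₀x * a₀y) ≡⟨ cong ((a₂x * a₂y) *_) (*-comm a₀x a₀y) ⟩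
    (a₂x * a₂y) * (a₀y * a₀x) ≡⟨ interchange a₂x a₂y a₀y a₀x ⟩
    (a₂x * a₀y) * (a₂y * a₀x) ∎)
    where
    open ≤-Reasoning
    a₀x = a x; a₁x = a (suc x); a₂x = a (suc (suc x))
    a₀y = a y; a₁y = a (suc y); a₂y = a (suc (suc y))
    interchange : ∀ p q r s → (p * q) * (r * s) ≡ (p * r) * (q * s)
    interchange = solve-∀

open LogConvexSequences using (LogConvex; logConvex⇒cross; centralBinomial; centralBinomial-logConvex)

open import Data.Integer hiding (suc)
open import Data.Integer.Properties
open import Algebra.Properties.CommutativeSemigroup +-commutativeSemigroup using (interchange)
open import Data.Integer.Tactic.RingSolver using (solve-∀)
open import Data.Nat using (ℕ; zero; suc; _∸_)
import Data.Nat as ℕ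
import Data.Nat.Properties as ℕ
open import Data.Nat.Combinatorics using (_C_; nCk+nC[k+1]≡[n+1]C[k+1]; k>n⇒nCk≡0)
open import Function using (_∘_)
open import Relation.Binary.PropositionalEquality
import Relation.Binary.Reasoning.Setoid (ℕ →-setoid ℤ) as ≗-Reasoning
open import Relation.Nullary using (yes; no)

sumTo-cong : ∀ n {g h : ℕ → ℤ} → (∀ i → i ℕ.≤ n → g i ≡ h i) → sumTo n g ≡ sumTo n h
sumTo-cong zero    g≡h = g≡h 0 ℕ.z≤n
sumTo-cong (suc n) g≡h = cong₂ _+_ (sumTo-cong n (λ i i≤n → g≡h i (ℕ.m≤n⇒m≤1+n i≤n))) (g≡h (suc n) ℕ.≤-refl)

sumTo-suc : ∀ n (g : ℕ → ℤ) → sumTo (suc n) g ≡ g 0 + sumTo n (g ∘ suc)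
sumTo-suc zero    g = refl
sumTo-suc (suc n) g = trans (cong (_+ g (suc (suc n))) (sumTo-suc n g)) (+-assoc (g 0) _ _)

sumTo-distrib-+ : ∀ n (g h : ℕ → ℤ) → sumTo n (λ i → g i + h i) ≡ sumTo n g + sumTo n h
sumTo-distrib-+ zero    g h = refl
sumTo-distrib-+ (suc n) g h =
  trans (cong (_+ (g (suc n) + h (suc n))) (sumTo-distrib-+ n g h)) (interchange (sumTo n g) (sumTo n h) (g (suc n)) (h (suc n)))

sumTo-neg : ∀ n (g : ℕ → ℤ) → sumTo n (λ i → - g i) ≡ - sumTo n g
sumTo-neg zero    g = refl
sumTo-neg (suc n) g =
  trans (cong (_+ - g (suc n)) (sumTo-neg n g)) (sym (neg-distrib-+ (sumTo n g) (g (suc n))))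

sumTo-distrib-- : ∀ n (g h : ℕ → ℤ) → sumTo n (λ i → g i - h i) ≡ sumTo n g - sumTo n h
sumTo-distrib-- n g h = trans (sumTo-distrib-+ n g (-_ ∘ h)) (cong (λ s → sumTo n g + s) (sumTo-neg n h))

sumTo-reverse : ∀ n (g : ℕ → ℤ) → sumTo n g ≡ sumTo n (λ i → g (n ∸ i))
sumTo-reverse zero    g = refl
sumTo-reverse (suc n) g = begin
  sumTo (suc n) g                           ≡⟨ sumTo-suc n g ⟩
  g 0 + sumTo n (g ∘ suc)                   ≡⟨ cong (λ s → g 0 + s) (sumTo-reverse n (g ∘ suc)) ⟩
  g 0 + sumTo n (λ i → g (suc (n ∸ i)))     ≡⟨ cong (λ s → g 0 + s) (sumTo-cong n (λ i i≤n → cong g (sym (ℕ.+-∸-assoc 1 i≤n)))) ⟩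
  g 0 + sumTo n (λ i → g (suc n ∸ i))       ≡⟨ +-comm (g 0) _ ⟩
  sumTo n (λ i → g (suc n ∸ i)) + g 0       ≡⟨ cong (λ j → sumTo n (λ i → g (suc n ∸ i)) + g j) (ℕ.n∸n≡0 n) ⟨
  sumTo (suc n) (λ i → g (suc n ∸ i))       ∎
  where open ≡-Reasoning

sumTo-nonneg : ∀ n (g : ℕ → ℤ) → (∀ i → i ℕ.≤ n → 0ℤ ≤ g i) → 0ℤ ≤ sumTo n g
sumTo-nonneg zero    g g≥0 = g≥0 0 ℕ.z≤n
sumTo-nonneg (suc n) g g≥0 =
  +-mono-≤ (sumTo-nonneg n g (λ i i≤n → g≥0 i (ℕ.m≤n⇒m≤1+n i≤n))) (g≥0 (suc n) ℕ.≤-refl)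

0≤i+i⇒0≤i : ∀ i → 0ℤ ≤ i + i → 0ℤ ≤ i
0≤i+i⇒0≤i i 0≤2i = *-cancelʳ-≤-pos 0ℤ i (+ 2) (subst (0ℤ ≤_) (i+i≡i*2 i) 0≤2i)
  where
  i+i≡i*2 : ∀ i → i + i ≡ i * + 2
  i+i≡i*2 = solve-∀

-- Pairing the terms i and n ∸ i, the sum is counted twice.
sumTo-nonneg-by-pairs : ∀ n (g : ℕ → ℤ) → (∀ i → i ℕ.≤ n → 0ℤ ≤ g i + g (n ∸ i)) → 0ℤ ≤ sumTo n g
sumTo-nonneg-by-pairs n g pairs≥0 = 0≤i+i⇒0≤i (sumTo n g) (subst (0ℤ ≤_) twice (sumTo-nonneg n _ pairs≥0))
  where
  twice : sumTo n (λ i → g i + g (n ∸ i)) ≡ sumTo n g + sumTo n g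
  twice = trans (sumTo-distrib-+ n g (λ i → g (n ∸ i))) (cong (λ s → sumTo n g + s) (sym (sumTo-reverse n g)))

infixl 6 _⊕_
infixr 8 q·_

_⊕_ : Poly → Poly → Poly
(p ⊕ r) k = p k + r k

q·_ : Poly → Poly
(q· p) zero    = 0ℤ
(q· p) (suc k) = p k

⊛-congˡ : ∀ p {r r′} → r ≗ r′ → (p ⊛ r) ≗ (p ⊛ r′)
⊛-congˡ p r≗r′ m = sumTo-cong m (λ i _ → cong (p i *_) (r≗r′ (m ∸ i)))

⊛-congʳ : ∀ r {p p′} → p ≗ p′ → (p ⊛ r) ≗ (p′ ⊛ r)
⊛-congʳ r p≗p′ m = sumTo-cong m (λ i _ → cong (_* r (m ∸ i)) (p≗p′ i))

⊝-cong : ∀ {p p′ r r′} → p ≗ p′ → r ≗ r′ → (p ⊝ r) ≗ (p′ ⊝ r′)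
⊝-cong p≗p′ r≗r′ m = cong₂ _-_ (p≗p′ m) (r≗r′ m)

⊛-comm : ∀ p r → (p ⊛ r) ≗ (r ⊛ p)
⊛-comm p r m = trans (sumTo-reverse m _) (sumTo-cong m (λ i i≤m →
  trans (cong (λ j → p (m ∸ i) * r j) (ℕ.m∸[m∸n]≡n i≤m)) (*-comm (p (m ∸ i)) (r i))))

⊛-distribʳ-⊕ : ∀ p r s → ((p ⊕ r) ⊛ s) ≗ ((p ⊛ s) ⊕ (r ⊛ s))
⊛-distribʳ-⊕ p r s m = trans (sumTo-cong m (λ i _ → *-distribʳ-+ (s (m ∸ i)) (p i) (r i))) (sumTo-distrib-+ m _ _)

⊛-distribˡ-⊕ : ∀ p r s → (p ⊛ (r ⊕ s)) ≗ ((p ⊛ r) ⊕ (p ⊛ s))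
⊛-distribˡ-⊕ p r s m = trans (sumTo-cong m (λ i _ → *-distribˡ-+ (p i) (r (m ∸ i)) (s (m ∸ i)))) (sumTo-distrib-+ m _ _)

q·-⊛ : ∀ p r → ((q· p) ⊛ r) ≗ q· (p ⊛ r)
q·-⊛ p r zero    = *-zeroˡ (r 0)
q·-⊛ p r (suc m) = trans (sumTo-suc m _) (trans (cong (_+ (p ⊛ r) m) (*-zeroˡ (r (suc m)))) (+-identityˡ _))

⊛-q· : ∀ p r → (p ⊛ (q· r)) ≗ q· (p ⊛ r)
⊛-q· p r zero    = trans (⊛-comm p (q· r) 0) (q·-⊛ r p 0)
⊛-q· p r (suc m) = trans (⊛-comm p (q· r) (suc m)) (trans (q·-⊛ r p (suc m)) (⊛-comm r p m))

-- The q-multiples of y ⊛ z cancel.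
[x+qy]z-y[w+qz]≗xz-yw : ∀ x y z w → (((x ⊕ q· y) ⊛ z) ⊝ (y ⊛ (w ⊕ q· z))) ≗ ((x ⊛ z) ⊝ (y ⊛ w))
[x+qy]z-y[w+qz]≗xz-yw x y z w m = begin
  ((x ⊕ q· y) ⊛ z) m - (y ⊛ (w ⊕ q· z)) m
    ≡⟨ cong₂ _-_ (trans (⊛-distribʳ-⊕ x (q· y) z m) (cong (λ s → (x ⊛ z) m + s) (q·-⊛ y z m)))
                 (trans (⊛-distribˡ-⊕ y w (q· z) m) (cong (λ s → (y ⊛ w) m + s) (⊛-q· y z m))) ⟩
  ((x ⊛ z) m + (q· (y ⊛ z)) m) - ((y ⊛ w) m + (q· (y ⊛ z)) m)
    ≡⟨ [a+c]-[b+c]≡a-b ((x ⊛ z) m) ((y ⊛ w) m) ((q· (y ⊛ z)) m) ⟩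
  (x ⊛ z) m - (y ⊛ w) m ∎
  where
  open ≡-Reasoning
  [a+c]-[b+c]≡a-b : ∀ a b c → (a + c) - (b + c) ≡ a - b
  [a+c]-[b+c]≡a-b = solve-∀

binomialTransform : (ℕ → ℕ) → ℕ → Poly
binomialTransform a n k = + (n C k) * + a (n ∸ k)

private
  -- When j ≥ u the index is truncated, but then the binomial coefficient vanishes.
  vanishing-or-equal : ∀ (a : ℕ → ℕ) u j → + (u C suc j) * + a (suc (u ∸ suc j)) ≡ + (u C suc j) * + a (u ∸ j)
  vanishing-or-equal a u j with j ℕ.<? u
  ... | yes j<u = cong (λ i → + (u C suc j) * + a i) (sym (ℕ.+-∸-assoc 1 {u} {suc j} j<u))
  ... | no  j≮u rewrite k>n⇒nCk≡0 (ℕ.s≤s (ℕ.≮⇒≥ j≮u)) = refl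

binomialTransform-suc : ∀ (a : ℕ → ℕ) u → binomialTransform a (suc u) ≗ (binomialTransform (a ∘ suc) u ⊕ q· binomialTransform a u)
binomialTransform-suc a u zero    = sym (+-identityʳ _)
binomialTransform-suc a u (suc j) = begin
  + (suc u C suc j) * A
    ≡⟨ cong (λ n → + n * A) (nCk+nC[k+1]≡[n+1]C[k+1] u j) ⟨
  + (u C j ℕ.+ u C suc j) * A
    ≡⟨ cong (_* A) (pos-+ (u C j) (u C suc j)) ⟩
  (+ (u C j) + + (u C suc j)) * A
    ≡⟨ *-distribʳ-+ A (+ (u C j)) (+ (u C suc j)) ⟩
  + (u C j) * A + + (u C suc j) * A
    ≡⟨ +-comm (+ (u C j) * A) _ ⟩
  + (u C suc j) * A + + (u C j) * A
    ≡⟨ cong (λ t → t + + (u C j) * A) (vanishing-or-equal a u j) ⟨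
  + (u C suc j) * + a (suc (u ∸ suc j)) + + (u C j) * A ∎
  where
  open ≡-Reasoning
  A = + a (u ∸ j)

binomialTransform-det : ∀ (a : ℕ → ℕ) N →
  ((binomialTransform a (suc (suc N)) ⊛ binomialTransform a N) ⊝ (binomialTransform a (suc N) ⊛ binomialTransform a (suc N)))
  ≗ ((binomialTransform (a ∘ suc ∘ suc) N ⊛ binomialTransform a N) ⊝ (binomialTransform (a ∘ suc) N ⊛ binomialTransform (a ∘ suc) N))
binomialTransform-det a N = begin
  (T (suc (suc N)) ⊛ A₀) ⊝ (T (suc N) ⊛ T (suc N))
    ≈⟨ ⊝-cong (⊛-congʳ A₀ (binomialTransform-suc a (suc N))) (⊛-congˡ (T (suc N)) (binomialTransform-suc a N)) ⟩
  ((T′ (suc N) ⊕ q· T (suc N)) ⊛ A₀) ⊝ (T (suc N) ⊛ (A₁ ⊕ q· A₀))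
    ≈⟨ [x+qy]z-y[w+qz]≗xz-yw (T′ (suc N)) (T (suc N)) A₀ A₁ ⟩
  (T′ (suc N) ⊛ A₀) ⊝ (T (suc N) ⊛ A₁)
    ≈⟨ ⊝-cong (⊛-congʳ A₀ (binomialTransform-suc (a ∘ suc) N))
              (λ m → trans (⊛-comm (T (suc N)) A₁ m) (⊛-congˡ A₁ (binomialTransform-suc a N) m)) ⟩
  ((A₂ ⊕ q· A₁) ⊛ A₀) ⊝ (A₁ ⊛ (A₁ ⊕ q· A₀))
    ≈⟨ [x+qy]z-y[w+qz]≗xz-yw A₂ A₁ A₀ A₁ ⟩
  (A₂ ⊛ A₀) ⊝ (A₁ ⊛ A₁) ∎
  where
  open ≗-Reasoning
  T T′ : ℕ → Poly
  T = binomialTransform a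
  T′ = binomialTransform (a ∘ suc)
  A₀ A₁ A₂ : Poly
  A₀ = T N
  A₁ = T′ N
  A₂ = binomialTransform (a ∘ suc ∘ suc) N

logConvex⇒crossℤ : ∀ {a} → LogConvex a → ∀ x y →
  0ℤ ≤ (+ a (suc (suc x)) * + a y + + a (suc (suc y)) * + a x) - + 2 * (+ a (suc x) * + a (suc y))
logConvex⇒crossℤ {a} logConvex x y =
  subst₂ (λ r l → 0ℤ ≤ r - l) right left (i≤j⇒0≤j-i (+≤+ (logConvex⇒cross {a} logConvex x y)))
  where
  right : + (a (suc (suc x)) ℕ.* a y ℕ.+ a (suc (suc y)) ℕ.* a x) ≡ + a (suc (suc x)) * + a y + + a (suc (suc y)) * + a x
  right = trans (pos-+ (a (suc (suc x)) ℕ.* a y) (a (suc (suc y)) ℕ.* a x)) (cong₂ _+_ (pos-* (a (suc (suc x))) (a y)) (pos-* (a (suc (suc y))) (a x)))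
  left : + (2 ℕ.* (a (suc x) ℕ.* a (suc y))) ≡ + 2 * (+ a (suc x) * + a (suc y))
  left = trans (pos-* 2 (a (suc x) ℕ.* a (suc y))) (cong (+ 2 *_) (pos-* (a (suc x)) (a (suc y))))

-- The terms i and m−i of the coefficient sum below, with u = C(N,i), v = C(N,m−i),
-- x = N−i and y = N−(m−i).
logConvex⇒pair-nonneg : ∀ {a} → LogConvex a → ∀ u v x y →
  0ℤ ≤ (+ u * + a (suc (suc x)) * (+ v * + a y) - + u * + a (suc x) * (+ v * + a (suc y)))
     + (+ v * + a (suc (suc y)) * (+ u * + a x) - + v * + a (suc y) * (+ u * + a (suc x)))
logConvex⇒pair-nonneg {a} logConvex u v x y = begin
  0ℤ                 ≡⟨ *-zeroʳ (+ (u ℕ.* v)) ⟨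
  + (u ℕ.* v) * 0ℤ   ≤⟨ *-monoˡ-≤-nonNeg (+ (u ℕ.* v)) (logConvex⇒crossℤ {a} logConvex x y) ⟩
  + (u ℕ.* v) * D    ≡⟨ cong (_* D) (pos-* u v) ⟩
  + u * + v * D      ≡⟨ expand (+ u) (+ v) a₂x a₀y a₂y a₀x a₁x a₁y ⟩
  (+ u * a₂x * (+ v * a₀y) - + u * a₁x * (+ v * a₁y)) + (+ v * a₂y * (+ u * a₀x) - + v * a₁y * (+ u * a₁x)) ∎
  where
  open ≤-Reasoning
  a₀x = + a x; a₁x = + a (suc x); a₂x = + a (suc (suc x))
  a₀y = + a y; a₁y = + a (suc y); a₂y = + a (suc (suc y))
  D = (a₂x * a₀y + a₂y * a₀x) - + 2 * (a₁x * a₁y)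
  expand : ∀ u v a₂x a₀y a₂y a₀x a₁x a₁y →
    u * v * ((a₂x * a₀y + a₂y * a₀x) - + 2 * (a₁x * a₁y))
    ≡ (u * a₂x * (v * a₀y) - u * a₁x * (v * a₁y)) + (v * a₂y * (u * a₀x) - v * a₁y * (u * a₁x))
  expand = solve-∀

binomialTransform-shiftedDet-nonneg : ∀ {a} → LogConvex a → ∀ N →
  NonnegCoeffs ((binomialTransform (a ∘ suc ∘ suc) N ⊛ binomialTransform a N) ⊝ (binomialTransform (a ∘ suc) N ⊛ binomialTransform (a ∘ suc) N))
binomialTransform-shiftedDet-nonneg {a} logConvex N m =
  subst (0ℤ ≤_) (sumTo-distrib-- m (λ i → A₂ i * A₀ (m ∸ i)) (λ i → A₁ i * A₁ (m ∸ i))) (sumTo-nonneg-by-pairs m t pair)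
  where
  A₀ A₁ A₂ : Poly
  A₀ = binomialTransform a N
  A₁ = binomialTransform (a ∘ suc) N
  A₂ = binomialTransform (a ∘ suc ∘ suc) N
  t : ℕ → ℤ
  t i = A₂ i * A₀ (m ∸ i) - A₁ i * A₁ (m ∸ i)
  pair : ∀ i → i ℕ.≤ m → 0ℤ ≤ t i + t (m ∸ i)
  pair i i≤m = subst (λ j → 0ℤ ≤ t i + (A₂ (m ∸ i) * A₀ j - A₁ (m ∸ i) * A₁ j)) (sym (ℕ.m∸[m∸n]≡n i≤m))
    (logConvex⇒pair-nonneg {a} logConvex (N C i) (N C (m ∸ i)) (N ∸ i) (N ∸ (m ∸ i)))

binomialTransform-qLogConvex : ∀ {a} → LogConvex a → QLogConvex (binomialTransform a)
binomialTransform-qLogConvex         logConvex zero    ()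
binomialTransform-qLogConvex {a} logConvex (suc N) _ m =
  subst (0ℤ ≤_) (sym (binomialTransform-det a N m)) (binomialTransform-shiftedDet-nonneg {a} logConvex N m)

QLogConvex-resp-≗ : ∀ {g h} → (∀ n → g n ≗ h n) → QLogConvex g → QLogConvex h
QLogConvex-resp-≗ {g} {h} g≗h logConvex n n≥1 m =
  subst (0ℤ ≤_) (⊝-cong (products (suc n) (n ∸ 1)) (products n n) m) (logConvex n n≥1 m)
  where
  products : ∀ i j → (g i ⊛ g j) ≗ (h i ⊛ h j)
  products i j k = trans (⊛-congʳ (g j) (g≗h i) k) (⊛-congˡ (h i) (g≗h j) k)

binomialTransform-centralBinomial≗f : ∀ n → binomialTransform centralBinomial n ≗ f n
binomialTransform-centralBinomial≗f n k =
  trans (sym (pos-* (n C k) (centralBinomial (n ∸ k)))) (cong (λ i → + ((n C k) ℕ.* (i C (n ∸ k)))) (ℕ.*-distribˡ-∸ 2 n k))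

theorem3p2 : QLogConvex f
theorem3p2 = QLogConvex-resp-≗ {binomialTransform centralBinomial} binomialTransform-centralBinomial≗f
  (binomialTransform-qLogConvex {centralBinomial} centralBinomial-logConvex)
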